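{- Let $a\in\mathbb{N}$. Then $f(a,a,2a)=2a-1$.
   Context: $\mathbb{N}$ denotes the positive integers and $[n]=\{1,\dots,n\}$. For $a,b,c\in\mathbb{N}$, $f(a,b,c)$ denotes the metric dimension of the Cartesian product $K_a\times K_b\times K_c$ of complete graphs (vertex set $[a]\times[b]\times[c]$, two triples adjacent iff they differ in exactly one coordinate); the metric dimension of a graph is the minimum size of a vertex set $U$ such that every vertex is uniquely determined by its vector of distances to the vertices of $U$. Equivalently, $f(a,b,c)$ is the minimum cardinality of a set $Q\subseteq[a]\times[b]\times[c]$ such that for all distinct $s,s'$ there is $q\in Q$ with $g(s,q)\neq g(s',q)$, where $g(s,q)$ is the number of indices $i\in[3]$ with $s_i=q_i$. -}

module Defs where

open import Data.Nat using (ℕ; _+_; _≤_)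
open import Data.Fin using (Fin; _≟_)
open import Data.Product using (_×_; _,_; ∃-syntax)
open import Data.List using (List; length)
open import Data.List.Membership.Propositional using (_∈_)
open import Data.List.Relation.Unary.Unique.Propositional using (Unique)
open import Relation.Binary.PropositionalEquality using (_≡_; _≢_)
open import Relation.Nullary using (yes; no)

-- Vertices of K_a × K_b × K_c : triples in [a] × [b] × [c]
Vertex : ℕ → ℕ → ℕ → Set
Vertex a b c = Fin a × Fin b × Fin c

agree : ∀ {n} → Fin n → Fin n → ℕ
agree i j with i ≟ j
... | yes _ = 1
... | no _ = 0

g : ∀ {a b c} → Vertex a b c → Vertex a b c → ℕ
g (s₁ , s₂ , s₃) (q₁ , q₂ , q₃) = agree s₁ q₁ + agree s₂ q₂ + agree s₃ q₃

Resolving : ∀ a b c → List (Vertex a b c) → Set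
Resolving a b c Q =
  ∀ (s s′ : Vertex a b c) → s ≢ s′ → ∃[ q ] (q ∈ Q × g s q ≢ g s′ q)

-- f(a,b,c) = k : k is the minimum cardinality of a resolving set
MetricDimIs : ℕ → ℕ → ℕ → ℕ → Set
MetricDimIs a b c k =
  (∃[ Q ] (Unique Q × Resolving a b c Q × length Q ≡ k))
  × (∀ (Q : List (Vertex a b c)) → Unique Q → Resolving a b c Q → k ≤ length Q)

-- Lower bound: (x, y, w) and (x, y, w′) are separated only by landmarks whose third coordinate
-- is w or w′, so a resolving set uses all but at most one of the 2a values of the third coordinate.
-- Upper bound: the staircase q_p = (⌊p/2⌋, ⌈p/2⌉, p), 0 ≤ p ≤ 2a − 2, is resolving. For
-- s = (x, y, z), g(s, q_p) counts how many of 2x, 2x + 1 (from x), 2y − 1, 2y (from y) and z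
-- equal p. Suppose s and s′ have the same profile. If x < x′, the two hits of s at 2x and 2x + 1
-- can only be matched by the y- and z-hits of s′, which pins y′ and z′ to that block; the hits of
-- s at 2y − 1 and 2y then force x′ = y − 1 and x′ = y (and for y = 0 the hit at 0 forces x′ = 0).
-- If x = x′ and y′ < y, then z′ must equal both 2y − 1 and 2y. If x = x′ and y = y′, the hit at
-- position z separates z from z′.

module Submission where

open import Defs
open import Data.Nat using (ℕ; _*_; _∸_; _≤_)

open import Data.Nat
  using (zero; suc; _+_; _<_; z≤n; s≤s; z<s; ⌊_/2⌋; ⌈_/2⌉)
open import Data.Nat.Properties
  using ( _≟_; <-cmp; ≤-trans; ≤-reflexive; <⇒≤; <-≤-trans; ≤-pred; <⇒≢; 1+n≢n
        ; +-suc; +-identityʳ; +-assoc; +-mono-≤; +-cancelˡ-≡; m+n≡0⇒m≡0; m+n≡0⇒n≡0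
        ; m≤m+n; m≤n+m; ⌊n/2⌋-mono; ⌈n/2⌉-mono; n≡⌊n+n/2⌋; n≡⌈n+n/2⌉
        ; +-commutativeSemigroup )
open import Algebra.Properties.CommutativeSemigroup +-commutativeSemigroup
  using (interchange)
open import Data.Fin using (Fin; zero; toℕ; fromℕ<; inject₁; punchIn)
import Data.Fin as Fin
open import Data.Fin.Properties
  using ( toℕ-injective; toℕ-fromℕ<; toℕ-inject₁; toℕ<n; toℕ≤pred[n]; inject₁-injective
        ; punchIn-injective; punchInᵢ≢i; injective⇒≤; all?; ¬∀⟶∃¬ )
open import Data.Product using (_×_; _,_; proj₁; proj₂)
open import Data.Sum using (_⊎_; inj₁; inj₂; fromInj₁)
open import Data.Empty using (⊥; ⊥-elim)
open import Data.List using (List; map; tabulate; lookup; length)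
open import Data.List.Properties using (length-map; length-tabulate)
open import Data.List.Relation.Unary.All as All using (All)
open import Data.List.Relation.Unary.All.Properties using (¬All⇒Any¬; tabulate⁻)
open import Data.List.Relation.Unary.Any using (index; any?)
open import Data.List.Relation.Unary.Any.Properties using (lookup-index)
open import Data.List.Membership.Propositional using (_∈_; find)
open import Data.List.Membership.Propositional.Properties using (∈-map⁺)
open import Data.List.Relation.Unary.Unique.Propositional using (Unique)
open import Data.List.Relation.Unary.Unique.Propositional.Properties using (tabulate⁺)
open import Relation.Binary.PropositionalEquality
  using (_≡_; _≢_; refl; sym; trans; cong; cong₂; subst; module ≡-Reasoning)
open import Relation.Binary.Definitions using (tri<; tri≈; tri>)
open import Relation.Nullary using (yes; no; contradiction)
open import Function using (_∘_)

private variable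
  i j k n x y z x′ y′ z′ x₀ y₀ z₀ : ℕ

-- Opaque, so that unification sees δ i j as rigid in i and j.
opaque
  δ : ℕ → ℕ → ℕ
  δ i j with i ≟ j
  ... | yes _ = 1
  ... | no _ = 0

  δ-refl : ∀ i → δ i i ≡ 1
  δ-refl i with i ≟ i
  ... | yes _ = refl
  ... | no i≢i = contradiction refl i≢i

  δ-≢ : i ≢ j → δ i j ≡ 0
  δ-≢ {i} {j} i≢j with i ≟ j
  ... | yes i≡j = contradiction i≡j i≢j
  ... | no _ = refl

  δ≤1 : ∀ i j → δ i j ≤ 1
  δ≤1 i j with i ≟ j
  ... | yes _ = s≤s z≤n
  ... | no _ = z≤n

  δ-pos⇒≡ : 0 < δ i j → i ≡ j
  δ-pos⇒≡ {i} {j} pos with i ≟ j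
  ... | yes i≡j = i≡j
  δ-pos⇒≡ () | no _

  δ≡0⇒≢ : δ i j ≡ 0 → i ≢ j
  δ≡0⇒≢ {i} δ≡0 refl = 1+n≢n (trans (sym (δ-refl i)) δ≡0)

  δ+δ≤1 : j ≢ k → δ i j + δ i k ≤ 1
  δ+δ≤1 {j} {k} {i} j≢k with i ≟ j
  ... | yes refl = ≤-reflexive (cong suc (δ-≢ j≢k))
  ... | no _ = δ≤1 i k

  δ+δ-pos : 0 < δ i j + δ i k → i ≡ j ⊎ i ≡ k
  δ+δ-pos {i} {j} pos with i ≟ j
  ... | yes i≡j = inj₁ i≡j
  ... | no _ = inj₂ (δ-pos⇒≡ pos)

two-units : ∀ {a b c} → b ≤ 1 → c ≤ 1 → 2 + a ≡ b + c → a ≡ 0 × b ≡ 1 × c ≡ 1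
two-units (s≤s z≤n) (s≤s z≤n) refl = refl , refl , refl
two-units (s≤s z≤n) z≤n       ()
two-units z≤n       (s≤s z≤n) ()
two-units z≤n       z≤n       ()

two-hits : ∀ {a₀ a₁ b₀ b₁ c₀ c₁} → b₀ + b₁ ≤ 1 → c₀ + c₁ ≤ 1
         → suc a₀ ≡ b₀ + c₀ → suc a₁ ≡ b₁ + c₁ → a₀ + a₁ ≡ 0 × b₀ + b₁ ≡ 1 × c₀ + c₁ ≡ 1
two-hits {a₀} {a₁} {b₀} {b₁} {c₀} {c₁} b≤1 c≤1 e₀ e₁ = two-units b≤1 c≤1 (begin
  2 + (a₀ + a₁)              ≡⟨ cong suc (+-suc a₀ a₁) ⟨
  suc a₀ + suc a₁            ≡⟨ cong₂ _+_ e₀ e₁ ⟩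
  (b₀ + c₀) + (b₁ + c₁)      ≡⟨ interchange b₀ c₀ b₁ c₁ ⟩
  (b₀ + b₁) + (c₀ + c₁)      ∎)
  where open ≡-Reasoning

ℕ³ : Set
ℕ³ = ℕ × ℕ × ℕ

matches : ℕ³ → ℕ³ → ℕ
matches (x , y , z) (x₀ , y₀ , z₀) = δ x x₀ + δ y y₀ + δ z z₀

matches-x-hit : matches (x , y , z) (x , y₀ , z₀) ≡ suc (δ y y₀ + δ z z₀)
matches-x-hit {x} = cong (λ d → d + _ + _) (δ-refl x)

matches-x-miss : x ≢ x₀ → matches (x , y , z) (x₀ , y₀ , z₀) ≡ δ y y₀ + δ z z₀
matches-x-miss x≢x₀ = cong (λ d → d + _ + _) (δ-≢ x≢x₀)

matches-x-hit-miss : x′ ≢ x₀ → matches (x₀ , y , z) (x₀ , y₀ , z₀) ≡ matches (x′ , y′ , z′) (x₀ , y₀ , z₀)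
                   → suc (δ y y₀ + δ z z₀) ≡ δ y′ y₀ + δ z′ z₀
matches-x-hit-miss x′≢x₀ eq = trans (sym matches-x-hit) (trans eq (matches-x-miss x′≢x₀))

matches-y-hit-pos : 0 < matches (x , y , z) (x₀ , y , z₀)
matches-y-hit-pos {x} {y} {z} {x₀} {z₀} =
  ≤-trans (≤-reflexive (sym (δ-refl y)))
          (≤-trans (m≤n+m (δ y y) (δ x x₀)) (m≤m+n _ (δ z z₀)))

matches-pos⇒x≡ : y ≢ y₀ → z ≢ z₀ → 0 < matches (x , y , z) (x₀ , y₀ , z₀) → x ≡ x₀
matches-pos⇒x≡ {x = x} {x₀ = x₀} y≢y₀ z≢z₀ pos = δ-pos⇒≡ (subst (0 <_) x-only pos)
  where
  x-only : matches (x , _ , _) (x₀ , _ , _) ≡ δ x x₀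
  x-only = trans (cong₂ (λ b c → δ x x₀ + b + c) (δ-≢ y≢y₀) (δ-≢ z≢z₀))
                 (trans (+-identityʳ _) (+-identityʳ _))

matches-cancel-x : matches (x , y , z) (x₀ , y₀ , z₀) ≡ matches (x , y′ , z′) (x₀ , y₀ , z₀)
                 → δ y y₀ + δ z z₀ ≡ δ y′ y₀ + δ z′ z₀
matches-cancel-x {x} {y} {z} {x₀} {y₀} {z₀} {y′} {z′} eq =
  +-cancelˡ-≡ (δ x x₀) _ _
    (trans (sym (+-assoc (δ x x₀) (δ y y₀) (δ z z₀))) (trans eq (+-assoc (δ x x₀) (δ y′ y₀) (δ z′ z₀))))

matches-y-hit-miss⇒z≡ : y′ ≢ y₀ → matches (x , y₀ , z) (x₀ , y₀ , z₀) ≡ matches (x , y′ , z′) (x₀ , y₀ , z₀)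
                      → z′ ≡ z₀
matches-y-hit-miss⇒z≡ {y′} {y₀} {x} {z} {x₀} {z₀} {z′} y′≢y₀ eq = δ-pos⇒≡ (subst (0 <_) z′-hit z<s)
  where
  open ≡-Reasoning
  z′-hit : suc (δ z z₀) ≡ δ z′ z₀
  z′-hit = begin
    suc (δ z z₀)          ≡⟨ cong (_+ δ z z₀) (δ-refl y₀) ⟨
    δ y₀ y₀ + δ z z₀      ≡⟨ matches-cancel-x eq ⟩
    δ y′ y₀ + δ z′ z₀     ≡⟨ cong (_+ δ z′ z₀) (δ-≢ y′≢y₀) ⟩
    δ z′ z₀               ∎

matches-z-hit-miss⇒z≡ : matches (x , y , z) (x₀ , y₀ , z) ≡ matches (x , y , z′) (x₀ , y₀ , z) → z′ ≡ z
matches-z-hit-miss⇒z≡ {x} {y} {z} {x₀} {y₀} {z′} eq = δ-pos⇒≡ (subst (0 <_) z′-hit z<s)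
  where
  z′-hit : 1 ≡ δ z′ z
  z′-hit = trans (sym (δ-refl z)) (+-cancelˡ-≡ (δ y y₀) (δ z z) (δ z′ z) (matches-cancel-x eq))

stair : ℕ → ℕ³
stair p = ⌊ p /2⌋ , ⌈ p /2⌉ , p

stair-even : ∀ j → stair (j + j) ≡ (j , j , j + j)
stair-even j = cong₂ _,_ (sym (n≡⌊n+n/2⌋ j)) (cong (_, j + j) (sym (n≡⌈n+n/2⌉ j)))

stair-odd : ∀ j → stair (suc (j + j)) ≡ (j , suc j , suc (j + j))
stair-odd j = cong₂ _,_ (sym (n≡⌈n+n/2⌉ j)) (cong (λ h → suc h , suc (j + j)) (sym (n≡⌊n+n/2⌋ j)))

even-≤ : j ≤ n → j + j ≤ n + n
even-≤ j≤n = +-mono-≤ j≤n j≤n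

odd-≤ : j < n → suc (j + j) ≤ n + n
odd-≤ j<n = +-mono-≤ j<n (<⇒≤ j<n)

InBox : ℕ → ℕ³ → Set
InBox n (x , y , z) = x ≤ n × y ≤ n × z ≤ suc (n + n)

-- A record rather than a Π-type, so that n, s and s′ can be inferred from a proof of it.
record SameProfile (n : ℕ) (s s′ : ℕ³) : Set where
  constructor same-profile
  field
    at : ∀ p → p ≤ n + n → matches s (stair p) ≡ matches s′ (stair p)

private variable
  p : ℕ
  s s′ q : ℕ³

same-profile-sym : SameProfile n s s′ → SameProfile n s′ s
same-profile-sym (same-profile at) = same-profile λ p p≤ → sym (at p p≤)

same-profile-at : SameProfile n s s′ → p ≤ n + n → stair p ≡ q → matches s q ≡ matches s′ q
same-profile-at (same-profile at) p≤ refl = at _ p≤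

⌊/2⌋-≢ : ⌊ z /2⌋ ≡ x → ⌊ p /2⌋ ≢ x → z ≢ p
⌊/2⌋-≢ ⌊z/2⌋≡x ⌊p/2⌋≢x refl = ⌊p/2⌋≢x ⌊z/2⌋≡x

x-block-covered : x < n → x′ ≢ x → SameProfile n (x , y , z) (x′ , y′ , z′)
                → y ≢ x × y ≢ suc x × y′ ≢ y × ⌊ z′ /2⌋ ≡ x
x-block-covered {x} {n} {x′} {y} {z} {y′} {z′} x<n x′≢x same =
  y≢x , y≢1+x , y′≢y , ⌊z′/2⌋≡x
  where
  even : suc (δ y x + δ z (x + x)) ≡ δ y′ x + δ z′ (x + x)
  even = matches-x-hit-miss x′≢x (same-profile-at same (even-≤ (<⇒≤ x<n)) (stair-even x))
  odd : suc (δ y (suc x) + δ z (suc (x + x))) ≡ δ y′ (suc x) + δ z′ (suc (x + x))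
  odd = matches-x-hit-miss x′≢x (same-profile-at same (odd-≤ x<n) (stair-odd x))
  saturated : (δ y x + δ z (x + x)) + (δ y (suc x) + δ z (suc (x + x))) ≡ 0
            × δ y′ x + δ y′ (suc x) ≡ 1
            × δ z′ (x + x) + δ z′ (suc (x + x)) ≡ 1
  saturated = two-hits {b₀ = δ y′ x} {δ y′ (suc x)} {δ z′ (x + x)} {δ z′ (suc (x + x))}
                       (δ+δ≤1 (1+n≢n ∘ sym)) (δ+δ≤1 (1+n≢n ∘ sym)) even odd
  y≢x : y ≢ x
  y≢x = δ≡0⇒≢ (m+n≡0⇒m≡0 _ (m+n≡0⇒m≡0 _ (proj₁ saturated)))
  y≢1+x : y ≢ suc x
  y≢1+x = δ≡0⇒≢ (m+n≡0⇒m≡0 _ (m+n≡0⇒n≡0 (δ y x + δ z (x + x)) (proj₁ saturated)))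
  y′≢y : y′ ≢ y
  y′≢y y′≡y with δ+δ-pos (≤-reflexive (sym (proj₁ (proj₂ saturated))))
  ... | inj₁ y′≡x = y≢x (trans (sym y′≡y) y′≡x)
  ... | inj₂ y′≡1+x = y≢1+x (trans (sym y′≡y) y′≡1+x)
  ⌊z′/2⌋≡x : ⌊ z′ /2⌋ ≡ x
  ⌊z′/2⌋≡x with δ+δ-pos (≤-reflexive (sym (proj₂ (proj₂ saturated))))
  ... | inj₁ z′≡2x = trans (cong ⌊_/2⌋ z′≡2x) (sym (n≡⌊n+n/2⌋ x))
  ... | inj₂ z′≡1+2x = trans (cong ⌊_/2⌋ z′≡1+2x) (sym (n≡⌈n+n/2⌉ x))

x<x′⇒¬same-profile : x < x′ → x′ ≤ n → y ≤ n → SameProfile n (x , y , z) (x′ , y′ , z′) → ⊥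
x<x′⇒¬same-profile {x} {x′} {n} {zero} {z} {y′} {z′} x<x′ x′≤n _ same
  with x-block-covered (<-≤-trans x<x′ x′≤n) (<⇒≢ x<x′ ∘ sym) same
... | y≢x , _ , y′≢y , ⌊z′/2⌋≡x = <⇒≢ (≤-trans (s≤s z≤n) x<x′) (sym x′≡0)
  where
  x′≡0 : x′ ≡ 0
  x′≡0 = matches-pos⇒x≡ y′≢y (⌊/2⌋-≢ ⌊z′/2⌋≡x y≢x)
           (subst (0 <_) (same-profile-at same z≤n refl) matches-y-hit-pos)
x<x′⇒¬same-profile {x} {x′} {n} {suc k} {z} {y′} {z′} x<x′ x′≤n k<n same
  with x-block-covered (<-≤-trans x<x′ x′≤n) (<⇒≢ x<x′ ∘ sym) same
... | y≢x , y≢1+x , y′≢y , ⌊z′/2⌋≡x = 1+n≢n (trans (sym x′≡1+k) x′≡k)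
  where
  x′≡k : x′ ≡ k
  x′≡k = matches-pos⇒x≡ y′≢y (⌊/2⌋-≢ ⌊z′/2⌋≡x (y≢1+x ∘ cong suc ∘ trans (n≡⌈n+n/2⌉ k)))
           (subst (0 <_) (same-profile-at same (odd-≤ k<n) (stair-odd k)) matches-y-hit-pos)
  x′≡1+k : x′ ≡ suc k
  x′≡1+k = matches-pos⇒x≡ y′≢y (⌊/2⌋-≢ ⌊z′/2⌋≡x (y≢x ∘ trans (n≡⌊n+n/2⌋ (suc k))))
             (subst (0 <_) (same-profile-at same (even-≤ k<n) (stair-even (suc k))) matches-y-hit-pos)

y′<y⇒¬same-profile : y′ < y → y ≤ n → SameProfile n (x , y , z) (x , y′ , z′) → ⊥
y′<y⇒¬same-profile {y = zero} () _ _
y′<y⇒¬same-profile {y′} {suc k} {n} {x} {z} {z′} y′<y k<n same =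
  1+n≢n (trans (cong suc (sym (+-suc k k))) (trans (sym z′≡even) z′≡odd))
  where
  z′≡odd : z′ ≡ suc (k + k)
  z′≡odd = matches-y-hit-miss⇒z≡ (<⇒≢ y′<y) (same-profile-at same (odd-≤ k<n) (stair-odd k))
  z′≡even : z′ ≡ suc k + suc k
  z′≡even = matches-y-hit-miss⇒z≡ (<⇒≢ y′<y) (same-profile-at same (even-≤ k<n) (stair-even (suc k)))

z<z′⇒¬same-profile : z < z′ → z′ ≤ suc (n + n) → SameProfile n (x , y , z) (x , y , z′) → ⊥
z<z′⇒¬same-profile {z} z<z′ z′≤ same =
  <⇒≢ z<z′ (sym (matches-z-hit-miss⇒z≡ (same-profile-at same (≤-pred (<-≤-trans z<z′ z′≤)) refl)))

same-profile⇒≡ : InBox n s → InBox n s′ → SameProfile n s s′ → s ≡ s′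
same-profile⇒≡ {n} {x , y , z} {x′ , y′ , z′} (x≤n , y≤n , z≤) (x′≤n , y′≤n , z′≤) same
  with <-cmp x x′
... | tri< x<x′ _ _ = ⊥-elim (x<x′⇒¬same-profile x<x′ x′≤n y≤n same)
... | tri> _ _ x′<x = ⊥-elim (x<x′⇒¬same-profile x′<x x≤n y′≤n (same-profile-sym same))
... | tri≈ _ refl _ with <-cmp y y′
...   | tri< y<y′ _ _ = ⊥-elim (y′<y⇒¬same-profile y<y′ y′≤n (same-profile-sym same))
...   | tri> _ _ y′<y = ⊥-elim (y′<y⇒¬same-profile y′<y y≤n same)
...   | tri≈ _ refl _ with <-cmp z z′
...     | tri< z<z′ _ _ = ⊥-elim (z<z′⇒¬same-profile z<z′ z′≤ same)
...     | tri> _ _ z′<z = ⊥-elim (z<z′⇒¬same-profile z′<z z≤ (same-profile-sym same))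
...     | tri≈ _ refl _ = refl

toℕ³ : ∀ {a b c} → Vertex a b c → ℕ³
toℕ³ (x , y , z) = toℕ x , toℕ y , toℕ z

toℕ³-injective : ∀ {a b c} {v v′ : Vertex a b c} → toℕ³ v ≡ toℕ³ v′ → v ≡ v′
toℕ³-injective eq =
  cong₂ _,_ (toℕ-injective (cong proj₁ eq))
            (cong₂ _,_ (toℕ-injective (cong (proj₁ ∘ proj₂) eq)) (toℕ-injective (cong (proj₂ ∘ proj₂) eq)))

agree≡δ : ∀ {m} (i j : Fin m) → agree i j ≡ δ (toℕ i) (toℕ j)
agree≡δ i j with i Fin.≟ j
... | yes refl = sym (δ-refl (toℕ i))
... | no i≢j = sym (δ-≢ (i≢j ∘ toℕ-injective))

g≡matches : ∀ {a b c} (v w : Vertex a b c) → g v w ≡ matches (toℕ³ v) (toℕ³ w)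
g≡matches (x , y , z) (x₀ , y₀ , z₀) =
  cong₂ _+_ (cong₂ _+_ (agree≡δ x x₀) (agree≡δ y y₀)) (agree≡δ z z₀)

2[1+n]∸1≡1+[n+n] : ∀ n → 2 * suc n ∸ 1 ≡ suc (n + n)
2[1+n]∸1≡1+[n+n] n = trans (+-suc n (n + 0)) (cong (λ m → suc (n + m)) (+-identityʳ n))

toℕ³-inBox : (v : Vertex (suc n) (suc n) (2 * suc n)) → InBox n (toℕ³ v)
toℕ³-inBox {n} (x , y , z) =
  toℕ≤pred[n] x , toℕ≤pred[n] y , subst (toℕ z ≤_) (2[1+n]∸1≡1+[n+n] n) (toℕ≤pred[n] z)

⌊/2⌋≤ : p ≤ n + n → ⌊ p /2⌋ ≤ n
⌊/2⌋≤ {n = n} p≤ = ≤-trans (⌊n/2⌋-mono p≤) (≤-reflexive (sym (n≡⌊n+n/2⌋ n)))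

⌈/2⌉≤ : p ≤ n + n → ⌈ p /2⌉ ≤ n
⌈/2⌉≤ {n = n} p≤ = ≤-trans (⌈n/2⌉-mono p≤) (≤-reflexive (sym (n≡⌈n+n/2⌉ n)))

stair-vertex : Fin (2 * suc n ∸ 1) → Vertex (suc n) (suc n) (2 * suc n)
stair-vertex {n} i = fromℕ< (s≤s (⌊/2⌋≤ i≤)) , fromℕ< (s≤s (⌈/2⌉≤ i≤)) , inject₁ i
  where
  i≤ : toℕ i ≤ n + n
  i≤ = ≤-pred (subst (toℕ i <_) (2[1+n]∸1≡1+[n+n] n) (toℕ<n i))

toℕ³-stair-vertex : (i : Fin (2 * suc n ∸ 1)) → toℕ³ (stair-vertex i) ≡ stair (toℕ i)
toℕ³-stair-vertex i = cong₂ _,_ (toℕ-fromℕ< _) (cong₂ _,_ (toℕ-fromℕ< _) (toℕ-inject₁ i))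

staircase : ∀ n → List (Vertex (suc n) (suc n) (2 * suc n))
staircase n = tabulate stair-vertex

staircase-unique : ∀ n → Unique (staircase n)
staircase-unique n = tabulate⁺ (λ eq → inject₁-injective (cong (proj₂ ∘ proj₂) eq))

Determining : ∀ a b c → List (Vertex a b c) → Set
Determining a b c Q = ∀ v v′ → All (λ q → g v q ≡ g v′ q) Q → v ≡ v′

determining⇒resolving : ∀ {a b c} (Q : List (Vertex a b c)) → Determining a b c Q → Resolving a b c Q
determining⇒resolving Q determining v v′ v≢v′ with All.all? (λ q → g v q ≟ g v′ q) Q
... | yes equal = contradiction (determining v v′ equal) v≢v′
... | no ¬equal = find (¬All⇒Any¬ (λ q → g v q ≟ g v′ q) Q ¬equal)

staircase-determining : ∀ n → Determining (suc n) (suc n) (2 * suc n) (staircase n)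
staircase-determining n v v′ equal =
  toℕ³-injective (same-profile⇒≡ (toℕ³-inBox v) (toℕ³-inBox v′) (same-profile same))
  where
  open ≡-Reasoning
  g-stair : ∀ w i → g w (stair-vertex i) ≡ matches (toℕ³ w) (stair (toℕ i))
  g-stair w i = trans (g≡matches w (stair-vertex i)) (cong (matches (toℕ³ w)) (toℕ³-stair-vertex i))
  same : ∀ p → p ≤ n + n → matches (toℕ³ v) (stair p) ≡ matches (toℕ³ v′) (stair p)
  same p p≤ = begin
    matches (toℕ³ v) (stair p)          ≡⟨ cong (matches (toℕ³ v) ∘ stair) (toℕ-fromℕ< p<) ⟨
    matches (toℕ³ v) (stair (toℕ p′))   ≡⟨ g-stair v p′ ⟨
    g v (stair-vertex p′)               ≡⟨ tabulate⁻ equal p′ ⟩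
    g v′ (stair-vertex p′)              ≡⟨ g-stair v′ p′ ⟩
    matches (toℕ³ v′) (stair (toℕ p′))  ≡⟨ cong (matches (toℕ³ v′) ∘ stair) (toℕ-fromℕ< p<) ⟩
    matches (toℕ³ v′) (stair p)         ∎
    where
    p< : p < 2 * suc n ∸ 1
    p< = subst (p <_) (sym (2[1+n]∸1≡1+[n+n] n)) (s≤s p≤)
    p′ : Fin (2 * suc n ∸ 1)
    p′ = fromℕ< p<

third : ∀ {a b c} → Vertex a b c → Fin c
third = proj₂ ∘ proj₂

agree-≢ : ∀ {m} {i j : Fin m} → i ≢ j → agree i j ≡ 0
agree-≢ {i = i} {j} i≢j = trans (agree≡δ i j) (δ-≢ (i≢j ∘ toℕ-injective))

resolving⇒thirds-cover : ∀ {a b c} {Q : List (Vertex a b c)} → Fin a → Fin b → Resolving a b c Q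
                       → ∀ w w′ → w ≢ w′ → w ∈ map third Q ⊎ w′ ∈ map third Q
resolving⇒thirds-cover {Q = Q} x y resolving w w′ w≢w′
  with resolving (x , y , w) (x , y , w′) (w≢w′ ∘ cong third)
... | q , q∈Q , g≢ with third q Fin.≟ w | third q Fin.≟ w′
...   | yes refl | _ = inj₁ (∈-map⁺ third q∈Q)
...   | no _ | yes refl = inj₂ (∈-map⁺ third q∈Q)
...   | no q₃≢w | no q₃≢w′ =
  contradiction (cong (agree x (proj₁ q) + agree y (proj₁ (proj₂ q)) +_)
                      (trans (agree-≢ (q₃≢w ∘ sym)) (sym (agree-≢ (q₃≢w′ ∘ sym)))))
                g≢

covers-all-but⇒length≥ : ∀ {m} (w₀ : Fin (suc m)) (L : List (Fin (suc m)))
                       → (∀ w → w ≢ w₀ → w ∈ L) → m ≤ length L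
covers-all-but⇒length≥ w₀ L covers = injective⇒≤ {f = index ∘ member} position-injective
  where
  member : ∀ i → punchIn w₀ i ∈ L
  member i = covers (punchIn w₀ i) (punchInᵢ≢i w₀ i)
  position-injective : ∀ {i j} → index (member i) ≡ index (member j) → i ≡ j
  position-injective {i} {j} eq =
    punchIn-injective w₀ i j
      (trans (lookup-index (member i)) (trans (cong (lookup L) eq) (sym (lookup-index (member j)))))

misses-at-most-one⇒length≥ : ∀ {m} (L : List (Fin (suc m)))
                           → (∀ w w′ → w ≢ w′ → w ∈ L ⊎ w′ ∈ L) → m ≤ length L
misses-at-most-one⇒length≥ {m} L covers with all? (λ w → any? (w Fin.≟_) L)
... | yes all∈L = covers-all-but⇒length≥ zero L (λ w _ → all∈L w)
... | no ¬all∈L with ¬∀⟶∃¬ (suc m) (_∈ L) (λ w → any? (w Fin.≟_) L) ¬all∈L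
...   | w₀ , w₀∉L = covers-all-but⇒length≥ w₀ L
                      (λ w w≢w₀ → fromInj₁ (λ w₀∈L → contradiction w₀∈L w₀∉L) (covers w w₀ w≢w₀))

resolving⇒length≥ : ∀ {a b m} → Fin a → Fin b → (Q : List (Vertex a b (suc m))) → Resolving a b (suc m) Q
                  → m ≤ length Q
resolving⇒length≥ {m = m} x y Q resolving =
  subst (m ≤_) (length-map third Q)
        (misses-at-most-one⇒length≥ (map third Q) (resolving⇒thirds-cover x y resolving))

theorem3 : ∀ (a : ℕ) → 1 ≤ a → MetricDimIs a a (2 * a) (2 * a ∸ 1)
theorem3 (suc n) _ =
    ( staircase n
    , staircase-unique n
    , determining⇒resolving (staircase n) (staircase-determining n)
    , length-tabulate stair-vertex )
  , λ Q _ resolving → resolving⇒length≥ zero zero Q resolving
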